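{- Let $S_1,S_2,S_3\subset[n]$ be pairwise disjoint sets and suppose that $\mathcal F_1,\mathcal F_2,\mathcal F_3\subset 2^{[n]}$ are cross partition-free. Then $$\sum_{i=1}^3\big|\mathcal F_i\cap\{S_i,\ S_{i_+}\cup S_{i_- }\}\big|\le 4.$$
   Context: Three families $\mathcal F_1,\mathcal F_2,\mathcal F_3\subset 2^{[n]}$ are cross partition-free if there is no choice of $A\in\mathcal F_1$, $B\in\mathcal F_2$, $C\in\mathcal F_3$ such that one of these three sets equals the disjoint union of the other two. For $i\in[3]$, $i_+=i+1$ and $i_-=i-1$ with the conventions $3_+=1$ and $1_-=3$. -}

module Defs where

open import Data.Nat using (ℕ; _+_)
open import Data.Bool using (Bool; true; false; if_then_else_) renaming (_≟_ to _≟ᵇ_)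
open import Data.Fin.Subset using (Subset; _∪_; _∩_; ⊥)
open import Data.Vec.Properties using (≡-dec)
open import Data.Product using (∃-syntax; _×_)
open import Data.Sum using (_⊎_)
open import Relation.Binary.PropositionalEquality using (_≡_)
open import Relation.Nullary using (¬_; yes; no)

Family : ℕ → Set
Family n = Subset n → Bool

_∈F_ : ∀ {n} → Subset n → Family n → Set
A ∈F F = F A ≡ true

Disj : ∀ {n} → Subset n → Subset n → Set
Disj A B = A ∩ B ≡ ⊥

DisjUnion : ∀ {n} → Subset n → Subset n → Subset n → Set
DisjUnion X Y Z = Disj Y Z × X ≡ Y ∪ Z

CrossPartitionFree : ∀ {n} → Family n → Family n → Family n → Set
CrossPartitionFree F₁ F₂ F₃ =
  ¬ (∃[ A ] ∃[ B ] ∃[ C ] (A ∈F F₁ × B ∈F F₂ × C ∈F F₃ ×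
       (DisjUnion A B C ⊎ DisjUnion B A C ⊎ DisjUnion C A B)))

ind : Bool → ℕ
ind true = 1
ind false = 0

_≟ˢ_ : ∀ {n} (A B : Subset n) → Relation.Nullary.Dec (A ≡ B)
_≟ˢ_ = ≡-dec _≟ᵇ_

pairCount : ∀ {n} → Family n → Subset n → Subset n → ℕ
pairCount F X Y with X ≟ˢ Y
... | yes _ = ind (F X)
... | no  _ = ind (F X) + ind (F Y)

module Submission where

-- Put a₁ = [S₁ ∈ F₁], b₁ = [S₂ ∪ S₃ ∈ F₁], a₂ = [S₂ ∈ F₂],
-- b₂ = [S₃ ∪ S₁ ∈ F₂], a₃ = [S₃ ∈ F₃], b₃ = [S₁ ∪ S₂ ∈ F₃].  Since the Sᵢ
-- are pairwise disjoint, cross partition-freeness forbids each of the three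
-- triples  {a₁, a₂, b₃},  {a₁, b₂, a₃},  {b₁, a₂, a₃}  from being all true,
-- so each triple contributes at most 2.  Adding the three triples counts
-- every bᵢ once and every aᵢ twice, hence, with A = a₁ + a₂ + a₃ and
-- t = Σ (aᵢ + bᵢ),
--     t + A ≤ 6    and trivially    t ≤ A + 3,
-- so 2t ≤ 9, i.e. t ≤ 4.  Finally |Fᵢ ∩ {X, Y}| ≤ [X ∈ Fᵢ] + [Y ∈ Fᵢ]
-- (with equality unless X = Y), which bounds the left-hand side by t.

open import Defs
open import Data.Nat using (ℕ; _+_; _≤_; z≤n; s≤s)
open import Defs
open import Data.Nat using (ℕ; _+_; _≤_; z≤n; s≤s)
open import Data.Nat.Properties
  using (≤-refl; ≤-trans; m≤m+n; +-mono-≤; +-monoʳ-≤; _≤?_; ≰⇒>; 1+n≰n; module ≤-Reasoning)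
open import Data.Nat.Tactic.RingSolver using (solve-∀)
open import Data.Fin.Subset using (Subset; _∪_)
open import Data.Fin.Subset.Properties using (∪-comm)
open import Data.Bool using (Bool; true; false)
open import Data.Product using (_×_; _,_)
open import Data.Sum using (inj₁; inj₂)
open import Relation.Binary.PropositionalEquality using (_≡_; refl)
open import Relation.Nullary using (¬_; yes; no; contradiction)

ind≤1 : ∀ b → ind b ≤ 1
ind≤1 true  = s≤s z≤n
ind≤1 false = z≤n

atMostTwo : ∀ x y z → ¬ (x ≡ true × y ≡ true × z ≡ true) →
            ind x + ind y + ind z ≤ 2
atMostTwo true  true  true  notAll = contradiction (refl , refl , refl) notAll
atMostTwo true  true  false _ = ≤-refl
atMostTwo true  false true  _ = ≤-refl
atMostTwo true  false false _ = s≤s z≤n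
atMostTwo false true  true  _ = ≤-refl
atMostTwo false true  false _ = s≤s z≤n
atMostTwo false false true  _ = s≤s z≤n
atMostTwo false false false _ = z≤n

half-of-9 : ∀ t → t + t ≤ 9 → t ≤ 4
half-of-9 t t+t≤9 with t ≤? 4
... | yes t≤4 = t≤4
... | no  t≰4 = contradiction (≤-trans (+-mono-≤ 5≤t 5≤t) t+t≤9) (1+n≰n {9})
  where
  5≤t : 5 ≤ t
  5≤t = ≰⇒> t≰4

triples-sum : ∀ a₁ b₁ a₂ b₂ a₃ b₃ →
  (a₁ + b₁) + (a₂ + b₂) + (a₃ + b₃) + (a₁ + a₂ + a₃)
    ≡ (a₁ + a₂ + b₃) + (a₁ + b₂ + a₃) + (b₁ + a₂ + a₃)
triples-sum = solve-∀

total-split : ∀ a₁ b₁ a₂ b₂ a₃ b₃ →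
  (a₁ + b₁) + (a₂ + b₂) + (a₃ + b₃) ≡ (a₁ + a₂ + a₃) + (b₁ + b₂ + b₃)
total-split = solve-∀

double-regroup : ∀ t A → (A + 3) + t ≡ (t + A) + 3
double-regroup = solve-∀

-- Counting core: six numbers, the bᵢ at most 1, whose three "forbidden
-- triples" each sum to at most 2, have total at most 4.  Indeed with
-- t the total and A = a₁ + a₂ + a₃ we get t + A ≤ 6 and t ≤ A + 3.
six-count-bound : ∀ a₁ b₁ a₂ b₂ a₃ b₃ → b₁ ≤ 1 → b₂ ≤ 1 → b₃ ≤ 1 →
  a₁ + a₂ + b₃ ≤ 2 → a₁ + b₂ + a₃ ≤ 2 → b₁ + a₂ + a₃ ≤ 2 →
  (a₁ + b₁) + (a₂ + b₂) + (a₃ + b₃) ≤ 4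
six-count-bound a₁ b₁ a₂ b₂ a₃ b₃ b₁≤1 b₂≤1 b₃≤1 T₁≤2 T₂≤2 T₃≤2 =
  half-of-9 t (begin
    t + t        ≤⟨ +-mono-≤ t≤A+3 ≤-refl ⟩
    (A + 3) + t  ≡⟨ double-regroup t A ⟩
    (t + A) + 3  ≤⟨ +-mono-≤ t+A≤6 ≤-refl ⟩
    9            ∎)
  where
  open ≤-Reasoning
  t A : ℕ
  t = (a₁ + b₁) + (a₂ + b₂) + (a₃ + b₃)
  A = a₁ + a₂ + a₃

  t+A≤6 : t + A ≤ 6
  t+A≤6 = begin
    t + A ≡⟨ triples-sum a₁ b₁ a₂ b₂ a₃ b₃ ⟩
    (a₁ + a₂ + b₃) + (a₁ + b₂ + a₃) + (b₁ + a₂ + a₃)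
          ≤⟨ +-mono-≤ (+-mono-≤ T₁≤2 T₂≤2) T₃≤2 ⟩
    6     ∎

  t≤A+3 : t ≤ A + 3
  t≤A+3 = begin
    t               ≡⟨ total-split a₁ b₁ a₂ b₂ a₃ b₃ ⟩
    A + (b₁ + b₂ + b₃) ≤⟨ +-monoʳ-≤ A (+-mono-≤ (+-mono-≤ b₁≤1 b₂≤1) b₃≤1) ⟩
    A + 3           ∎

pairCount≤ : ∀ {n} (F : Family n) X Y → pairCount F X Y ≤ ind (F X) + ind (F Y)
pairCount≤ F X Y with X ≟ˢ Y
... | yes _ = m≤m+n _ _
... | no  _ = ≤-refl

module _ {n} {F₁ F₂ F₃ : Family n} (cpf : CrossPartitionFree F₁ F₂ F₃)
         {X Y : Subset n} (disj : Disj X Y) where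

  union-in-F₁ : ¬ ((X ∪ Y) ∈F F₁ × X ∈F F₂ × Y ∈F F₃)
  union-in-F₁ (p , q , r) = cpf (X ∪ Y , X , Y , p , q , r , inj₁ (disj , refl))

  union-in-F₂ : ¬ (X ∈F F₁ × (Y ∪ X) ∈F F₂ × Y ∈F F₃)
  union-in-F₂ (p , q , r) =
    cpf (X , Y ∪ X , Y , p , q , r , inj₂ (inj₁ (disj , ∪-comm Y X)))

  union-in-F₃ : ¬ (X ∈F F₁ × Y ∈F F₂ × (X ∪ Y) ∈F F₃)
  union-in-F₃ (p , q , r) =
    cpf (X , Y , X ∪ Y , p , q , r , inj₂ (inj₂ (disj , refl)))

claim1 : (n : ℕ) (S₁ S₂ S₃ : Subset n) (F₁ F₂ F₃ : Family n) →
         Disj S₁ S₂ → Disj S₁ S₃ → Disj S₂ S₃ →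
         CrossPartitionFree F₁ F₂ F₃ →
         pairCount F₁ S₁ (S₂ ∪ S₃) + pairCount F₂ S₂ (S₃ ∪ S₁) + pairCount F₃ S₃ (S₁ ∪ S₂) ≤ 4
claim1 _ S₁ S₂ S₃ F₁ F₂ F₃ d₁₂ d₁₃ d₂₃ cpf =
  ≤-trans
    (+-mono-≤ (+-mono-≤ (pairCount≤ F₁ S₁ (S₂ ∪ S₃)) (pairCount≤ F₂ S₂ (S₃ ∪ S₁)))
              (pairCount≤ F₃ S₃ (S₁ ∪ S₂)))
    (six-count-bound (ind a₁) (ind b₁) (ind a₂) (ind b₂) (ind a₃) (ind b₃)
       (ind≤1 b₁) (ind≤1 b₂) (ind≤1 b₃)
       (atMostTwo a₁ a₂ b₃ (union-in-F₃ cpf d₁₂))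
       (atMostTwo a₁ b₂ a₃ (union-in-F₂ cpf d₁₃))
       (atMostTwo b₁ a₂ a₃ (union-in-F₁ cpf d₂₃)))
  where
  a₁ b₁ a₂ b₂ a₃ b₃ : Bool
  a₁ = F₁ S₁ ; b₁ = F₁ (S₂ ∪ S₃)
  a₂ = F₂ S₂ ; b₂ = F₂ (S₃ ∪ S₁)
  a₃ = F₃ S₃ ; b₃ = F₃ (S₁ ∪ S₂)
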